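{- Let $H=\mathbb{Z}_2\times\mathbb{Z}_3\times\mathbb{Z}_6$ (written additively, elements written as strings $xyz$ with $x\in\mathbb{Z}_2$, $y\in\mathbb{Z}_3$, $z\in\mathbb{Z}_6$), let $N=\{0\}\times\mathbb{Z}_3\times\{0\}$, and let $$D=\{000,002,004,005,011,023,100,101,114,122,123,125\}.$$ Then $D$ is a $(12,3,12,4)$-relative difference set in $H$ relative to $N$, and the incidence graph of its development is the Suetake graph, i.e. the distance-regular graph with intersection array $\{12,11,8,1;1,4,11,12\}$. In particular, the Suetake graph is a Cayley graph.
   Context: For a finite group $H$ with subgroup $N$ of order $r$ and index $m$, a $k$-subset $D\subseteq H$ is an $(m,r,k,\mu)$-relative difference set relative to $N$ if every non-identity $h\in H$ can be written as $d_1-d_2$ with $d_1,d_2\in D$ in exactly $0$ ways if $h\in N$ and exactly $\mu$ ways if $h\notin N$. The development of $D$ has point set $H$ and blocks $D+h$, $h\in H$; its incidence graph is the bipartite graph on points and blocks with a point adjacent to a block iff it lies in it. A connected graph of diameter $d$ is distance-regular with intersection array $\{b_0,\dots,b_{d-1};c_1,\dots,c_d\}$ if for all vertices $x,y$ at distance $i$, the number of neighbours of $x$ at distance $i+1$ (resp. $i-1$) from $y$ is $b_i$ (resp. $c_i$). The Suetake graph is the (known to be unique) distance-regular graph with intersection array $\{12,11,8,1;1,4,11,12\}$. A graph is a Cayley graph if it is isomorphic to some $\mathrm{Cay}(G,S)$ (vertex set $G$, $a\sim b$ iff $ab^{ -1}\in S$, $S=S^{ -1}\subseteq G\setminus\{e\}$).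 -}

module Defs where

open import Level using (0ℓ)
open import Data.Bool using (Bool; true; false; _∧_; _∨_; not; if_then_else_)
open import Data.Nat using (ℕ; zero; suc; _+_; _*_; _∸_; _≡ᵇ_)
open import Data.Nat.DivMod using (_mod_)
open import Data.Fin using (Fin; toℕ; #_)
open import Data.Fin.Properties using () renaming (_≟_ to _≟F_)
open import Data.Bool.ListAction using (any)
open import Data.List using (List; []; _∷_; allFin; concatMap; map; foldr; length; filter)
open import Data.Vec using (Vec; lookup; []; _∷_)
open import Data.Product using (Σ; _×_; _,_; ∃; ∃-syntax)
open import Data.Sum using (_⊎_; inj₁; inj₂)
open import Relation.Binary.PropositionalEquality using (_≡_; _≢_)
open import Relation.Nullary using (¬_; Dec; yes; no)
open import Relation.Nullary.Decidable using (⌊_⌋)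
open import Function.Bundles using (_⇔_)
open import Algebra.Bundles using (Group)
import Data.Product.Properties
import Data.Sum.Properties

count : {A : Set} → (A → Bool) → List A → ℕ
count P []       = 0
count P (x ∷ xs) = (if P x then 1 else 0) + count P xs

addZ : ∀ {k} → Fin (suc k) → Fin (suc k) → Fin (suc k)
addZ {k} a b = (toℕ a + toℕ b) mod (suc k)

subZ : ∀ {k} → Fin (suc k) → Fin (suc k) → Fin (suc k)
subZ {k} a b = (toℕ a + (suc k ∸ toℕ b)) mod (suc k)

H : Set
H = Fin 2 × Fin 3 × Fin 6

_+H_ : H → H → H
(x , y , z) +H (x' , y' , z') = addZ x x' , addZ y y' , addZ z z'

_-H_ : H → H → H
(x , y , z) -H (x' , y' , z') = subZ x x' , subZ y y' , subZ z z'

0H : H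
0H = # 0 , # 0 , # 0

_==H_ : H → H → Bool
(x , y , z) ==H (x' , y' , z') = ⌊ x ≟F x' ⌋ ∧ (⌊ y ≟F y' ⌋ ∧ ⌊ z ≟F z' ⌋)

elemsH : List H
elemsH = concatMap (λ x → concatMap (λ y → map (λ z → (x , y , z)) (allFin 6)) (allFin 3)) (allFin 2)

diffCount : (H → Bool) → H → ℕ
diffCount D h = count (λ p → (Data.Product.proj₁ p -H Data.Product.proj₂ p) ==H h)
                      (concatMap (λ d₁ → map (λ d₂ → (d₁ , d₂)) (filter′ D elemsH)) (filter′ D elemsH))
  where
  filter′ : (H → Bool) → List H → List H
  filter′ P []       = []
  filter′ P (x ∷ xs) = if P x then x ∷ filter′ P xs else filter′ P xs

IsSubgroupH : (H → Bool) → Set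
IsSubgroupH N = (N 0H ≡ true) × (∀ a b → N a ≡ true → N b ≡ true → N (a -H b) ≡ true)

IsRDS : ℕ → ℕ → ℕ → ℕ → (N D : H → Bool) → Set
IsRDS m r k μ N D =
  IsSubgroupH N ×
  (count N elemsH ≡ r) ×
  (m * r ≡ length elemsH) ×
  (count D elemsH ≡ k) ×
  (∀ h → (h ==H 0H) ≡ false →
     diffCount D h ≡ (if N h then 0 else μ))

-- Finite graphs (vertex type with an exhaustive duplicate-free list)

record FinGraph : Set₁ where
  field
    V     : Set
    _≟V_  : (x y : V) → Dec (x ≡ y)
    verts : List V
    adj   : V → V → Bool

module _ (G : FinGraph) where
  open FinGraph G

  reach : ℕ → V → V → Bool
  reach zero    x y = ⌊ x ≟V y ⌋
  reach (suc k) x y = reach k x y ∨ any (λ z → adj x z ∧ reach k z y) verts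

  atDist : V → V → ℕ → Bool
  atDist x y zero    = ⌊ x ≟V y ⌋
  atDist x y (suc i) = reach (suc i) x y ∧ not (reach i x y)

  -- simple, connected, of diameter d, distance-regular with
  -- intersection array {b₀,…,b_{d-1}; c₁,…,c_d}  (c i stands for c_{i+1})
  IsDistanceRegular : (d : ℕ) → Vec ℕ d → Vec ℕ d → Set
  IsDistanceRegular d b c =
    (∀ x y → adj x y ≡ adj y x) ×
    (∀ x → adj x x ≡ false) ×
    (∀ x y → reach d x y ≡ true) ×
    (∃[ x ] ∃[ y ] atDist x y d ≡ true) ×
    (∀ x y (i : Fin d) → atDist x y (toℕ i) ≡ true →
       count (λ z → adj x z ∧ atDist z y (suc (toℕ i))) verts ≡ lookup b i) ×
    (∀ x y (i : Fin d) → atDist x y (suc (toℕ i)) ≡ true →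
       count (λ z → adj x z ∧ atDist z y (toℕ i)) verts ≡ lookup c i)

  IsCayleyGraph : Set₁
  IsCayleyGraph =
    Σ (Group 0ℓ 0ℓ) λ Γ → let open Group Γ in
    Σ (Carrier → Set) λ S →
    Σ (V → Carrier) λ f →
      (∀ {g h} → g ≈ h → S g → S h) ×
      (∀ g → S g → S (g ⁻¹)) ×
      (¬ S ε) ×
      (∀ x y → f x ≈ f y → x ≡ y) ×
      (∀ g → ∃[ x ] f x ≈ g) ×
      (∀ x y → (adj x y ≡ true) ⇔ S (f x ∙ (f y) ⁻¹))

-- Development of a subset D ⊆ H and its incidence graph.
-- Points: inj₁ p (p ∈ H); blocks: inj₂ h, the block D + h (h ∈ H).
-- p lies in D + h iff p - h ∈ D.

incidenceGraph : (D : H → Bool) → FinGraph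
incidenceGraph D = record
  { V     = H ⊎ H
  ; _≟V_  = dec
  ; verts = map inj₁ elemsH Data.List.++ map inj₂ elemsH
  ; adj   = ad
  }
  where
  ad : H ⊎ H → H ⊎ H → Bool
  ad (inj₁ p) (inj₂ h) = D (p -H h)
  ad (inj₂ h) (inj₁ p) = D (p -H h)
  ad _        _        = false
  decH : (a b : H) → Dec (a ≡ b)
  decH = Data.Product.Properties.≡-dec _≟F_ (Data.Product.Properties.≡-dec _≟F_ _≟F_)
  dec : (a b : H ⊎ H) → Dec (a ≡ b)
  dec = Data.Sum.Properties.≡-dec decH decH

Nset : H → Bool
Nset (x , y , z) = ⌊ x ≟F # 0 ⌋ ∧ ⌊ z ≟F # 0 ⌋

Dlist : List H
Dlist = (# 0 , # 0 , # 0) ∷ (# 0 , # 0 , # 2) ∷ (# 0 , # 0 , # 4) ∷ (# 0 , # 0 , # 5)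
      ∷ (# 0 , # 1 , # 1) ∷ (# 0 , # 2 , # 3) ∷ (# 1 , # 0 , # 0) ∷ (# 1 , # 0 , # 1)
      ∷ (# 1 , # 1 , # 4) ∷ (# 1 , # 2 , # 2) ∷ (# 1 , # 2 , # 3) ∷ (# 1 , # 2 , # 5) ∷ []

Dset : H → Bool
Dset h = any (h ==H_) Dlist

-- The differences of D are counted directly. The maps p ↦ p - g (on points and on blocks) and
-- x ↦ g - x (exchanging points and blocks) are automorphisms of the development, and one of them
-- moves any given vertex to the point 0, so distances and intersection numbers need only be
-- computed from 0. Together these maps form the generalized dihedral group of H acting
-- regularly on the vertices, which is why the development is a Cayley graph of that group.

module Submission where

open import Defs
open import Level using (0ℓ)
open import Algebra.Bundles using (AbelianGroup; Group)
open import Data.Bool using (Bool; true; false; T; not; _∧_; _∨_; _xor_; if_then_else_)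
open import Data.Bool.ListAction using (or; any; all)
open import Data.Bool.Properties using (T-≡; T-∧; xor-assoc; xor-identityʳ; ∨-isCommutativeMonoid)
import Data.Bool.Properties as Bool
open import Data.Fin using (Fin; zero; suc; toℕ; #_)
open import Data.Fin.Properties using (toℕ-fromℕ<; toℕ-injective; toℕ<n) renaming (_≟_ to _≟F_)
open import Data.List using (List; []; _∷_; _++_; map; allFin)
open import Data.List.Properties using (map-++; map-∘; map-cong)
open import Data.List.Relation.Binary.Permutation.Propositional using (_↭_; ↭-refl; ↭-sym; ↭-trans; ↭-reflexive; ↭⇒↭ₛ; prep; swap)
open import Data.List.Relation.Binary.Permutation.Propositional.Properties using (map⁺; ++⁺; ++-comm)
open import Data.List.Relation.Binary.Permutation.Setoid.Properties using (foldr-commMonoid)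
open import Data.List.Relation.Unary.All.Properties using (all⁺; tabulate⁻)
open import Data.Maybe using (Maybe; just; nothing; maybe)
import Data.Maybe as Maybe
open import Data.Nat using (ℕ; zero; suc; _+_; _∸_; _%_; _≤ᵇ_; _≡ᵇ_; _≤_; NonZero)
open import Data.Nat.DivMod using (_mod_; %-distribˡ-+; m%n%n≡m%n; m<n⇒m%n≡m; n%n≡0)
open import Data.Nat.ListAction using (sum)
open import Data.Nat.ListAction.Properties using (sum-↭)
open import Data.Nat.Properties using (+-comm; +-assoc; m+[n∸m]≡n; <⇒≤; ≡ᵇ⇒≡; ≤⇒≤ᵇ; ≤ᵇ⇒≤; ≤-trans; m≤m+n)
open import Data.Product using (_×_; _,_; proj₁; proj₂; ∃-syntax)
open import Data.Product.Properties using (≡-dec)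
open import Data.Product.Relation.Binary.Pointwise.NonDependent using (Pointwise; ×-isEquivalence)
open import Data.Sum using (_⊎_; inj₁; inj₂)
open import Data.Sum.Properties using (inj₁-injective; inj₂-injective)
open import Data.Vec using (Vec; []; _∷_; lookup)
open import Function using (_∘_; _⇔_; mk⇔; Equivalence)
open import Relation.Binary.Definitions using (DecidableEquality)
open import Relation.Binary.PropositionalEquality using (_≡_; refl; sym; trans; cong; cong₂; _≗_; module ≡-Reasoning)
import Relation.Binary.PropositionalEquality as ≡
open import Relation.Nullary.Decidable using (yes; no; does; ⌊_⌋; toWitness; does-⇔; isYes≗does)

-- Abelian groups and generalized dihedral groups

module AbelianGroupProperties {c ℓ} (A : AbelianGroup c ℓ) where

  open AbelianGroup A renaming (trans to ≈-trans)
  open import Algebra.Properties.AbelianGroup A using (\\-leftDividesʳ; ⁻¹-anti-homo‿-; ⁻¹-involutive)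
  open import Relation.Binary.Reasoning.Setoid setoid

  [x-z]∙[z-y]≈x-y : ∀ x y z → (x - z) ∙ (z - y) ≈ x - y
  [x-z]∙[z-y]≈x-y x y z = begin
    (x ∙ z ⁻¹) ∙ (z ∙ y ⁻¹)   ≈⟨ assoc x (z ⁻¹) (z ∙ y ⁻¹) ⟩
    x ∙ (z ⁻¹ ∙ (z ∙ y ⁻¹))   ≈⟨ ∙-congˡ (\\-leftDividesʳ z (y ⁻¹)) ⟩
    x ∙ y ⁻¹                  ∎

  [x-z]-[y-z]≈x-y : ∀ x y z → (x - z) - (y - z) ≈ x - y
  [x-z]-[y-z]≈x-y x y z = begin
    (x - z) ∙ (y - z) ⁻¹      ≈⟨ ∙-congˡ (⁻¹-anti-homo‿- y z) ⟩
    (x - z) ∙ (z - y)         ≈⟨ [x-z]∙[z-y]≈x-y x y z ⟩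
    x - y                     ∎

  [z-y]-[z-x]≈x-y : ∀ x y z → (z - y) - (z - x) ≈ x - y
  [z-y]-[z-x]≈x-y x y z = begin
    (z - y) ∙ (z - x) ⁻¹      ≈⟨ ∙-congˡ (⁻¹-anti-homo‿- z x) ⟩
    (z - y) ∙ (x - z)         ≈⟨ comm (z - y) (x - z) ⟩
    (x - z) ∙ (z - y)         ≈⟨ [x-z]∙[z-y]≈x-y x y z ⟩
    x - y                     ∎

  y⁻¹∙x⁻¹⁻¹≈x-y : ∀ x y → y ⁻¹ ∙ x ⁻¹ ⁻¹ ≈ x - y
  y⁻¹∙x⁻¹⁻¹≈x-y x y = ≈-trans (∙-congˡ (⁻¹-involutive x)) (comm (y ⁻¹) x)

module GeneralizedDihedral {c ℓ} (A : AbelianGroup c ℓ) where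

  open AbelianGroup A renaming (refl to ≈-refl; sym to ≈-sym; trans to ≈-trans)
  open import Algebra.Properties.AbelianGroup A using (⁻¹-involutive; ⁻¹-∙-comm; ε⁻¹≈ε)
  open import Relation.Binary.Reasoning.Setoid setoid

  twist : Bool → Carrier → Carrier
  twist false a = a
  twist true  a = a ⁻¹

  twist-cong : ∀ s {a b} → a ≈ b → twist s a ≈ twist s b
  twist-cong false a≈b = a≈b
  twist-cong true  a≈b = ⁻¹-cong a≈b

  twist-homo : ∀ s a b → twist s (a ∙ b) ≈ twist s a ∙ twist s b
  twist-homo false a b = ≈-refl
  twist-homo true  a b = ≈-sym (⁻¹-∙-comm a b)

  twist-twist : ∀ s t a → twist s (twist t a) ≈ twist (s xor t) a
  twist-twist false t     a = ≈-refl
  twist-twist true  false a = ≈-refl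
  twist-twist true  true  a = ⁻¹-involutive a

  twist-ε : ∀ s → twist s ε ≈ ε
  twist-ε false = ≈-refl
  twist-ε true  = ε⁻¹≈ε

  Dih : Set c
  Dih = Carrier × Bool

  _≈ᴰ_ : Dih → Dih → Set ℓ
  _≈ᴰ_ = Pointwise _≈_ _≡_

  _·_ : Dih → Dih → Dih
  (a , s) · (b , t) = (a ∙ twist s b , s xor t)

  e : Dih
  e = (ε , false)

  inv : Dih → Dih
  inv (a , false) = (a ⁻¹ , false)
  inv (a , true)  = (a , true)

  ·-assoc : ∀ x y z → ((x · y) · z) ≈ᴰ (x · (y · z))
  ·-assoc (a , s) (b , t) (c , u) = first , xor-assoc s t u
    where
    first : (a ∙ twist s b) ∙ twist (s xor t) c ≈ a ∙ twist s (b ∙ twist t c)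
    first = begin
      (a ∙ twist s b) ∙ twist (s xor t) c          ≈⟨ assoc a (twist s b) (twist (s xor t) c) ⟩
      a ∙ (twist s b ∙ twist (s xor t) c)          ≈⟨ ∙-congˡ (∙-congˡ (twist-twist s t c)) ⟨
      a ∙ (twist s b ∙ twist s (twist t c))        ≈⟨ ∙-congˡ (twist-homo s b (twist t c)) ⟨
      a ∙ twist s (b ∙ twist t c)                  ∎

  ·-identityˡ : ∀ x → (e · x) ≈ᴰ x
  ·-identityˡ (a , s) = identityˡ a , refl

  ·-identityʳ : ∀ x → (x · e) ≈ᴰ x
  ·-identityʳ (a , s) = ≈-trans (∙-congˡ (twist-ε s)) (identityʳ a) , xor-identityʳ s

  ·-inverseˡ : ∀ x → (inv x · x) ≈ᴰ e
  ·-inverseˡ (a , false) = inverseˡ a , refl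
  ·-inverseˡ (a , true)  = inverseʳ a , refl

  ·-inverseʳ : ∀ x → (x · inv x) ≈ᴰ e
  ·-inverseʳ (a , false) = inverseʳ a , refl
  ·-inverseʳ (a , true)  = inverseʳ a , refl

  ·-cong : ∀ {x y u v} → x ≈ᴰ y → u ≈ᴰ v → (x · u) ≈ᴰ (y · v)
  ·-cong {_ , s} (a≈b , refl) (c≈d , refl) = ∙-cong a≈b (twist-cong s c≈d) , refl

  inv-cong : ∀ {x y} → x ≈ᴰ y → inv x ≈ᴰ inv y
  inv-cong {_ , false} (a≈b , refl) = ⁻¹-cong a≈b , refl
  inv-cong {_ , true}  (a≈b , refl) = a≈b , refl

  dihedralGroup : Group c ℓ
  dihedralGroup = record
    { Carrier = Dih
    ; _≈_     = _≈ᴰ_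
    ; _∙_     = _·_
    ; ε       = e
    ; _⁻¹     = inv
    ; isGroup = record
      { isMonoid = record
        { isSemigroup = record
          { isMagma = record
            { isEquivalence = ×-isEquivalence isEquivalence ≡.isEquivalence
            ; ∙-cong        = ·-cong
            }
          ; assoc = ·-assoc
          }
        ; identity = ·-identityˡ , ·-identityʳ
        }
      ; inverse = ·-inverseˡ , ·-inverseʳ
      ; ⁻¹-cong = inv-cong
      }
    }

-- ℤ/n and the group H

[m%d+o]%d≡[m+o]%d : ∀ m o d .{{_ : NonZero d}} → (m % d + o) % d ≡ (m + o) % d
[m%d+o]%d≡[m+o]%d m o d = begin
  (m % d + o) % d            ≡⟨ %-distribˡ-+ (m % d) o d ⟩
  (m % d % d + o % d) % d    ≡⟨ cong (λ x → (x + o % d) % d) (m%n%n≡m%n m d) ⟩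
  (m % d + o % d) % d        ≡⟨ %-distribˡ-+ m o d ⟨
  (m + o) % d                ∎
  where open ≡-Reasoning

[m+o%d]%d≡[m+o]%d : ∀ m o d .{{_ : NonZero d}} → (m + o % d) % d ≡ (m + o) % d
[m+o%d]%d≡[m+o]%d m o d = begin
  (m + o % d) % d  ≡⟨ cong (_% d) (+-comm m (o % d)) ⟩
  (o % d + m) % d  ≡⟨ [m%d+o]%d≡[m+o]%d o m d ⟩
  (o + m) % d      ≡⟨ cong (_% d) (+-comm o m) ⟩
  (m + o) % d      ∎
  where open ≡-Reasoning

module _ {k : ℕ} where

  private
    n : ℕ
    n = suc k

  open ≡-Reasoning

  negZ : Fin n → Fin n
  negZ = subZ zero

  toℕ-addZ : ∀ a b → toℕ (addZ a b) ≡ (toℕ a + toℕ b) % n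
  toℕ-addZ a b = toℕ-fromℕ< _

  addZ-comm : ∀ a b → addZ a b ≡ addZ b a
  addZ-comm a b = cong (_mod n) (+-comm (toℕ a) (toℕ b))

  addZ-identityˡ : ∀ a → addZ zero a ≡ a
  addZ-identityˡ a = toℕ-injective (trans (toℕ-addZ zero a) (m<n⇒m%n≡m (toℕ<n a)))

  addZ-assoc : ∀ a b c → addZ (addZ a b) c ≡ addZ a (addZ b c)
  addZ-assoc a b c = toℕ-injective (begin
    toℕ (addZ (addZ a b) c)                  ≡⟨ toℕ-addZ (addZ a b) c ⟩
    (toℕ (addZ a b) + toℕ c) % n             ≡⟨ cong (λ x → (x + toℕ c) % n) (toℕ-addZ a b) ⟩
    ((toℕ a + toℕ b) % n + toℕ c) % n        ≡⟨ [m%d+o]%d≡[m+o]%d (toℕ a + toℕ b) (toℕ c) n ⟩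
    (toℕ a + toℕ b + toℕ c) % n              ≡⟨ cong (_% n) (+-assoc (toℕ a) (toℕ b) (toℕ c)) ⟩
    (toℕ a + (toℕ b + toℕ c)) % n            ≡⟨ [m+o%d]%d≡[m+o]%d (toℕ a) (toℕ b + toℕ c) n ⟨
    (toℕ a + (toℕ b + toℕ c) % n) % n        ≡⟨ cong (λ x → (toℕ a + x) % n) (toℕ-addZ b c) ⟨
    (toℕ a + toℕ (addZ b c)) % n             ≡⟨ toℕ-addZ a (addZ b c) ⟨
    toℕ (addZ a (addZ b c))                  ∎)

  subZ-as-addZ : ∀ a b → subZ a b ≡ addZ a (negZ b)
  subZ-as-addZ a b = toℕ-injective (begin
    toℕ (subZ a b)                           ≡⟨ toℕ-fromℕ< _ ⟩
    (toℕ a + (n ∸ toℕ b)) % n                ≡⟨ [m+o%d]%d≡[m+o]%d (toℕ a) (n ∸ toℕ b) n ⟨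
    (toℕ a + (n ∸ toℕ b) % n) % n            ≡⟨ cong (λ x → (toℕ a + x) % n) (toℕ-fromℕ< _) ⟨
    (toℕ a + toℕ (negZ b)) % n               ≡⟨ toℕ-addZ a (negZ b) ⟨
    toℕ (addZ a (negZ b))                    ∎)

  addZ-inverseʳ : ∀ a → addZ a (negZ a) ≡ zero
  addZ-inverseʳ a = toℕ-injective (begin
    toℕ (addZ a (negZ a))                    ≡⟨ cong toℕ (subZ-as-addZ a a) ⟨
    toℕ (subZ a a)                           ≡⟨ toℕ-fromℕ< _ ⟩
    (toℕ a + (n ∸ toℕ a)) % n                ≡⟨ cong (_% n) (m+[n∸m]≡n (<⇒≤ (toℕ<n a))) ⟩
    n % n                                    ≡⟨ n%n≡0 n ⟩
    0                                        ∎)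

+H-assoc : ∀ a b c → (a +H b) +H c ≡ a +H (b +H c)
+H-assoc (a₁ , a₂ , a₃) (b₁ , b₂ , b₃) (c₁ , c₂ , c₃) =
  cong₂ _,_ (addZ-assoc a₁ b₁ c₁) (cong₂ _,_ (addZ-assoc a₂ b₂ c₂) (addZ-assoc a₃ b₃ c₃))

+H-comm : ∀ a b → a +H b ≡ b +H a
+H-comm (a₁ , a₂ , a₃) (b₁ , b₂ , b₃) =
  cong₂ _,_ (addZ-comm a₁ b₁) (cong₂ _,_ (addZ-comm a₂ b₂) (addZ-comm a₃ b₃))

+H-identityˡ : ∀ a → 0H +H a ≡ a
+H-identityˡ (a₁ , a₂ , a₃) =
  cong₂ _,_ (addZ-identityˡ a₁) (cong₂ _,_ (addZ-identityˡ a₂) (addZ-identityˡ a₃))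

+H-inverseʳ : ∀ a → a +H (0H -H a) ≡ 0H
+H-inverseʳ (a₁ , a₂ , a₃) =
  cong₂ _,_ (addZ-inverseʳ a₁) (cong₂ _,_ (addZ-inverseʳ a₂) (addZ-inverseʳ a₃))

-H-as-+H : ∀ a b → a -H b ≡ a +H (0H -H b)
-H-as-+H (a₁ , a₂ , a₃) (b₁ , b₂ , b₃) =
  cong₂ _,_ (subZ-as-addZ a₁ b₁) (cong₂ _,_ (subZ-as-addZ a₂ b₂) (subZ-as-addZ a₃ b₃))

H-abelianGroup : AbelianGroup 0ℓ 0ℓ
H-abelianGroup = record
  { Carrier        = H
  ; _≈_            = _≡_
  ; _∙_            = _+H_
  ; ε              = 0H
  ; _⁻¹            = 0H -H_
  ; isAbelianGroup = record
    { isGroup = record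
      { isMonoid = record
        { isSemigroup = record
          { isMagma = record { isEquivalence = ≡.isEquivalence ; ∙-cong = cong₂ _+H_ }
          ; assoc   = +H-assoc
          }
        ; identity = +H-identityˡ , λ a → trans (+H-comm a 0H) (+H-identityˡ a)
        }
      ; inverse = (λ a → trans (+H-comm (0H -H a) a) (+H-inverseʳ a)) , +H-inverseʳ
      ; ⁻¹-cong = cong (0H -H_)
      }
    ; comm = +H-comm
    }
  }

open AbelianGroup H-abelianGroup using (_-_)
open AbelianGroupProperties H-abelianGroup
open import Algebra.Properties.AbelianGroup H-abelianGroup using (⁻¹-involutive; ⁻¹-injective; x∙y⁻¹≈ε⇒x≈y)

[x-z]-[y-z]≡x-y : ∀ x y z → (x -H z) -H (y -H z) ≡ x -H y
[x-z]-[y-z]≡x-y x y z = begin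
  (x -H z) -H (y -H z)   ≡⟨ -H-as-+H (x -H z) (y -H z) ⟩
  (x -H z) - (y -H z)    ≡⟨ cong₂ _-_ (-H-as-+H x z) (-H-as-+H y z) ⟩
  (x - z) - (y - z)      ≡⟨ [x-z]-[y-z]≈x-y x y z ⟩
  x - y                  ≡⟨ -H-as-+H x y ⟨
  x -H y                 ∎
  where open ≡-Reasoning

[z-y]-[z-x]≡x-y : ∀ x y z → (z -H y) -H (z -H x) ≡ x -H y
[z-y]-[z-x]≡x-y x y z = begin
  (z -H y) -H (z -H x)   ≡⟨ -H-as-+H (z -H y) (z -H x) ⟩
  (z -H y) - (z -H x)    ≡⟨ cong₂ _-_ (-H-as-+H z y) (-H-as-+H z x) ⟩
  (z - y) - (z - x)      ≡⟨ [z-y]-[z-x]≈x-y x y z ⟩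
  x - y                  ≡⟨ -H-as-+H x y ⟨
  x -H y                 ∎
  where open ≡-Reasoning

x-x≡0 : ∀ x → x -H x ≡ 0H
x-x≡0 x = trans (-H-as-+H x x) (+H-inverseʳ x)

x-y≡0⇒x≡y : ∀ {x y} → x -H y ≡ 0H → x ≡ y
x-y≡0⇒x≡y {x} {y} eq = x∙y⁻¹≈ε⇒x≈y x y (trans (sym (-H-as-+H x y)) eq)

-H-cancelʳ : ∀ {x y} z → x -H z ≡ y -H z → x ≡ y
-H-cancelʳ {x} {y} z eq = x-y≡0⇒x≡y (begin
  x -H y                  ≡⟨ [x-z]-[y-z]≡x-y x y z ⟨
  (x -H z) -H (y -H z)    ≡⟨ cong (_-H (y -H z)) eq ⟩
  (y -H z) -H (y -H z)    ≡⟨ x-x≡0 (y -H z) ⟩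
  0H                      ∎)
  where open ≡-Reasoning

-H-cancelˡ : ∀ {x y} z → z -H x ≡ z -H y → x ≡ y
-H-cancelˡ {x} {y} z eq = x-y≡0⇒x≡y (begin
  x -H y                  ≡⟨ [z-y]-[z-x]≡x-y x y z ⟨
  (z -H y) -H (z -H x)    ≡⟨ cong ((z -H y) -H_) eq ⟩
  (z -H y) -H (z -H y)    ≡⟨ x-x≡0 (z -H y) ⟩
  0H                      ∎)
  where open ≡-Reasoning

module _ {A : Set} where

  count≡sum : ∀ (f : A → Bool) xs → count f xs ≡ sum (map (λ x → if f x then 1 else 0) xs)
  count≡sum f []       = refl
  count≡sum f (x ∷ xs) = cong ((if f x then 1 else 0) +_) (count≡sum f xs)

  count-↭ : ∀ (f : A → Bool) {xs ys} → xs ↭ ys → count f xs ≡ count f ys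
  count-↭ f {xs} {ys} p = begin
    count f xs                                   ≡⟨ count≡sum f xs ⟩
    sum (map (λ x → if f x then 1 else 0) xs)    ≡⟨ sum-↭ (map⁺ (λ x → if f x then 1 else 0) p) ⟩
    sum (map (λ x → if f x then 1 else 0) ys)    ≡⟨ count≡sum f ys ⟨
    count f ys                                   ∎
    where open ≡-Reasoning

  count-map : ∀ {B : Set} (f : B → Bool) (φ : A → B) xs → count f (map φ xs) ≡ count (f ∘ φ) xs
  count-map f φ []       = refl
  count-map f φ (x ∷ xs) = cong ((if f (φ x) then 1 else 0) +_) (count-map f φ xs)

  count-cong : ∀ {f g : A → Bool} → f ≗ g → ∀ xs → count f xs ≡ count g xs
  count-cong f≗g []       = refl
  count-cong f≗g (x ∷ xs) = cong₂ (λ b m → (if b then 1 else 0) + m) (f≗g x) (count-cong f≗g xs)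

  any-↭ : ∀ (f : A → Bool) {xs ys} → xs ↭ ys → any f xs ≡ any f ys
  any-↭ f p = foldr-commMonoid (≡.setoid Bool) ∨-isCommutativeMonoid (↭⇒↭ₛ (map⁺ f p))

  any-map : ∀ {B : Set} (f : B → Bool) (φ : A → B) xs → any f (map φ xs) ≡ any (f ∘ φ) xs
  any-map f φ xs = cong or (sym (map-∘ xs))

  any-cong : ∀ {f g : A → Bool} → f ≗ g → ∀ xs → any f xs ≡ any g xs
  any-cong f≗g xs = cong or (map-cong f≗g xs)

module PermutationCheck {A : Set} (_≟_ : DecidableEquality A) where

  remove : A → List A → Maybe (List A)
  remove x []       = nothing
  remove x (y ∷ ys) with x ≟ y
  ... | yes _ = just ys
  ... | no _  = Maybe.map (y ∷_) (remove x ys)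

  isPermutation : List A → List A → Bool
  isPermutation []       []      = true
  isPermutation []       (_ ∷ _) = false
  isPermutation (x ∷ xs) ys      = maybe (isPermutation xs) false (remove x ys)

  remove-↭ : ∀ x ys {zs} → remove x ys ≡ just zs → ys ↭ x ∷ zs
  remove-↭ x (y ∷ ys) eq with x ≟ y
  remove-↭ x (.x ∷ ys) refl | yes refl = ↭-refl
  ... | no _ with remove x ys in eq′
  remove-↭ x (y ∷ ys) refl | no _ | just ws = ↭-trans (prep y (remove-↭ x ys eq′)) (swap y x ↭-refl)

  isPermutation-sound : ∀ xs ys → T (isPermutation xs ys) → xs ↭ ys
  isPermutation-sound []       []      _ = ↭-refl
  isPermutation-sound (x ∷ xs) ys      t with remove x ys in eq
  ... | just zs = ↭-trans (prep x (isPermutation-sound xs zs t)) (↭-sym (remove-↭ x ys eq))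

allFin-sound : ∀ {n} (p : Fin n → Bool) → T (all p (allFin n)) → ∀ i → T (p i)
allFin-sound p t = tabulate⁻ (all⁺ p (allFin _) t)

allFin² : ∀ {m n} → (Fin m → Fin n → Bool) → Bool
allFin² {m} {n} p = all (λ x → all (p x) (allFin n)) (allFin m)

allFin²-sound : ∀ {m n} (p : Fin m → Fin n → Bool) → T (allFin² p) → ∀ x y → T (p x y)
allFin²-sound p t x = allFin-sound (p x) (allFin-sound (λ x → all (p x) (allFin _)) t x)

allH : (H → Bool) → Bool
allH p = allFin² (λ x y → all (λ z → p (x , y , z)) (allFin 6))

allH-sound : ∀ p → T (allH p) → ∀ h → T (p h)
allH-sound p t (x , y , z) =
  allFin-sound (λ z → p (x , y , z)) (allFin²-sound (λ x y → all (λ z → p (x , y , z)) (allFin 6)) t x y) z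

allV : (H ⊎ H → Bool) → Bool
allV p = allH (p ∘ inj₁) ∧ allH (p ∘ inj₂)

allV-sound : ∀ p → T (allV p) → ∀ v → T (p v)
allV-sound p t (inj₁ h) = allH-sound (p ∘ inj₁) (proj₁ (Equivalence.to (T-∧ {allH (p ∘ inj₁)}) t)) h
allV-sound p t (inj₂ h) = allH-sound (p ∘ inj₂) (proj₂ (Equivalence.to (T-∧ {allH (p ∘ inj₁)}) t)) h

≗-by-computation : {f g : H ⊎ H → Bool} → T (allV (λ v → ⌊ f v Bool.≟ g v ⌋)) → f ≗ g
≗-by-computation {f} {g} t v = toWitness (allV-sound (λ v → ⌊ f v Bool.≟ g v ⌋) t v)

T-∨-resolve : ∀ {a b} → T (a ∨ b) → a ≡ false → T b
T-∨-resolve t refl = t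

-- Automorphisms and distances in finite graphs

module _ (G : FinGraph) where

  open FinGraph G

  record Automorphism : Set where
    field
      apply           : V → V
      apply-injective : ∀ {x y} → apply x ≡ apply y → x ≡ y
      adj-apply       : ∀ x y → adj (apply x) (apply y) ≡ adj x y
      verts-apply     : map apply verts ↭ verts

  neighboursAt : V → V → ℕ → ℕ
  neighboursAt x y i = count (λ z → adj x z ∧ atDist G z y i) verts

  expand : (V → Bool) → V → Bool
  expand ball z = ball z ∨ any (λ w → adj z w ∧ ball w) verts

  expand-inflationary : ∀ {ball} z → ball z ≡ true → expand ball z ≡ true
  expand-inflationary z ball[z] rewrite ball[z] = refl

  reach-suc : ∀ {k y ball} → (∀ z → reach G k z y ≡ ball z) → ∀ z → reach G (suc k) z y ≡ expand ball z
  reach-suc reach≗ball z =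
    cong₂ _∨_ (reach≗ball z) (any-cong (λ w → cong (adj z w ∧_) (reach≗ball w)) verts)

  module _ (φ : Automorphism) where

    open Automorphism φ

    any-apply : ∀ f → any (f ∘ apply) verts ≡ any f verts
    any-apply f = trans (sym (any-map f apply verts)) (any-↭ f verts-apply)

    count-apply : ∀ f → count (f ∘ apply) verts ≡ count f verts
    count-apply f = trans (sym (count-map f apply verts)) (count-↭ f verts-apply)

    reach-apply : ∀ k x y → reach G k (apply x) (apply y) ≡ reach G k x y
    reach-apply zero    x y = begin
      ⌊ apply x ≟V apply y ⌋      ≡⟨ isYes≗does (apply x ≟V apply y) ⟩
      does (apply x ≟V apply y)   ≡⟨ does-⇔ (mk⇔ apply-injective (cong apply)) (apply x ≟V apply y) (x ≟V y) ⟩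
      does (x ≟V y)               ≡⟨ isYes≗does (x ≟V y) ⟨
      ⌊ x ≟V y ⌋                  ∎
      where open ≡-Reasoning
    reach-apply (suc k) x y = cong₂ _∨_ (reach-apply k x y) (begin
      any (λ z → adj (apply x) z ∧ reach G k z (apply y)) verts
        ≡⟨ any-apply (λ z → adj (apply x) z ∧ reach G k z (apply y)) ⟨
      any (λ z → adj (apply x) (apply z) ∧ reach G k (apply z) (apply y)) verts
        ≡⟨ any-cong (λ z → cong₂ _∧_ (adj-apply x z) (reach-apply k z y)) verts ⟩
      any (λ z → adj x z ∧ reach G k z y) verts ∎)
      where open ≡-Reasoning

    atDist-apply : ∀ x y i → atDist G (apply x) (apply y) i ≡ atDist G x y i
    atDist-apply x y zero    = reach-apply 0 x y
    atDist-apply x y (suc i) = cong₂ (λ a b → a ∧ not b) (reach-apply (suc i) x y) (reach-apply i x y)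

    neighboursAt-apply : ∀ x y i → neighboursAt (apply x) (apply y) i ≡ neighboursAt x y i
    neighboursAt-apply x y i = trans
      (sym (count-apply (λ z → adj (apply x) z ∧ atDist G z (apply y) i)))
      (count-cong (λ z → cong₂ _∧_ (adj-apply x z) (atDist-apply z y i)) verts)

m≤ᵇ0≡m≡ᵇ0 : ∀ m → (m ≤ᵇ 0) ≡ (m ≡ᵇ 0)
m≤ᵇ0≡m≡ᵇ0 zero    = refl
m≤ᵇ0≡m≡ᵇ0 (suc m) = refl

[m≤ᵇ1+n]∧¬[m≤ᵇn]≡[m≡ᵇ1+n] : ∀ m n → ((m ≤ᵇ suc n) ∧ not (m ≤ᵇ n)) ≡ (m ≡ᵇ suc n)
[m≤ᵇ1+n]∧¬[m≤ᵇn]≡[m≡ᵇ1+n] zero          n       = refl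
[m≤ᵇ1+n]∧¬[m≤ᵇn]≡[m≡ᵇ1+n] (suc zero)    zero    = refl
[m≤ᵇ1+n]∧¬[m≤ᵇn]≡[m≡ᵇ1+n] (suc (suc m)) zero    = refl
[m≤ᵇ1+n]∧¬[m≤ᵇn]≡[m≡ᵇ1+n] (suc zero)    (suc n) = refl
[m≤ᵇ1+n]∧¬[m≤ᵇn]≡[m≡ᵇ1+n] (suc (suc m)) (suc n) = [m≤ᵇ1+n]∧¬[m≤ᵇn]≡[m≡ᵇ1+n] (suc m) n

-- The relative difference set

N-closed : ∀ a b → Nset a ≡ true → Nset b ≡ true → Nset (a -H b) ≡ true
N-closed (zero  , _ , zero)  (zero  , _ , zero)  _  _  = refl
N-closed (suc _ , _ , _)     _                   () _
N-closed (zero  , _ , suc _) _                   () _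
N-closed (zero  , _ , zero)  (suc _ , _ , _)     _  ()
N-closed (zero  , _ , zero)  (zero  , _ , suc _) _  ()

differenceCheck : H → Bool
differenceCheck h = (h ==H 0H) ∨ (diffCount Dset h ≡ᵇ (if Nset h then 0 else 4))

D-isRDS : IsRDS 12 3 12 4 Nset Dset
D-isRDS = (refl , N-closed) , refl , refl , refl ,
  λ h h≢0 → ≡ᵇ⇒≡ _ _ (T-∨-resolve (allH-sound differenceCheck _ h) h≢0)

Dev : FinGraph
Dev = incidenceGraph Dset

open FinGraph Dev using (verts; adj)

_≟H_ : DecidableEquality H
_≟H_ = ≡-dec _≟F_ (≡-dec _≟F_ _≟F_)

open PermutationCheck _≟H_

map[x-g]↭elemsH : ∀ g → map (_-H g) elemsH ↭ elemsH
map[x-g]↭elemsH g = isPermutation-sound (map (_-H g) elemsH) elemsH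
  (allH-sound (λ g → isPermutation (map (_-H g) elemsH) elemsH) _ g)

map[g-x]↭elemsH : ∀ g → map (g -H_) elemsH ↭ elemsH
map[g-x]↭elemsH g = isPermutation-sound (map (g -H_) elemsH) elemsH
  (allH-sound (λ g → isPermutation (map (g -H_) elemsH) elemsH) _ g)

map-intertwined-↭ : ∀ (φ : H ⊎ H → H ⊎ H) (ι ι′ : H → H ⊎ H) (f : H → H) →
            (∀ p → φ (ι p) ≡ ι′ (f p)) → map f elemsH ↭ elemsH → map φ (map ι elemsH) ↭ map ι′ elemsH
map-intertwined-↭ φ ι ι′ f φ∘ι≗ι′∘f f-permutes = ↭-trans (↭-reflexive (begin
  map φ (map ι elemsH)    ≡⟨ map-∘ {g = φ} {f = ι} elemsH ⟨
  map (φ ∘ ι) elemsH      ≡⟨ map-cong φ∘ι≗ι′∘f elemsH ⟩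
  map (ι′ ∘ f) elemsH     ≡⟨ map-∘ {g = ι′} {f = f} elemsH ⟩
  map ι′ (map f elemsH)   ∎)) (map⁺ ι′ f-permutes)
  where open ≡-Reasoning

shift : H → H ⊎ H → H ⊎ H
shift g (inj₁ p) = inj₁ (p -H g)
shift g (inj₂ h) = inj₂ (h -H g)

reflect : H → H ⊎ H → H ⊎ H
reflect g (inj₁ p) = inj₂ (g -H p)
reflect g (inj₂ h) = inj₁ (g -H h)

translation : H → Automorphism Dev
translation g = record
  { apply           = shift g
  ; apply-injective = injective
  ; adj-apply       = adj-shift
  ; verts-apply     = ↭-trans (↭-reflexive (map-++ (shift g) (map inj₁ elemsH) (map inj₂ elemsH)))
                        (++⁺ (map-intertwined-↭ (shift g) inj₁ inj₁ (_-H g) (λ _ → refl) (map[x-g]↭elemsH g))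
                             (map-intertwined-↭ (shift g) inj₂ inj₂ (_-H g) (λ _ → refl) (map[x-g]↭elemsH g)))
  }
  where
  injective : ∀ {x y} → shift g x ≡ shift g y → x ≡ y
  injective {inj₁ _} {inj₁ _} eq = cong inj₁ (-H-cancelʳ g (inj₁-injective eq))
  injective {inj₂ _} {inj₂ _} eq = cong inj₂ (-H-cancelʳ g (inj₂-injective eq))
  adj-shift : ∀ x y → adj (shift g x) (shift g y) ≡ adj x y
  adj-shift (inj₁ p) (inj₁ q) = refl
  adj-shift (inj₁ p) (inj₂ h) = cong Dset ([x-z]-[y-z]≡x-y p h g)
  adj-shift (inj₂ h) (inj₁ p) = cong Dset ([x-z]-[y-z]≡x-y p h g)
  adj-shift (inj₂ h) (inj₂ k) = refl

reflection : H → Automorphism Dev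
reflection g = record
  { apply           = reflect g
  ; apply-injective = injective
  ; adj-apply       = adj-reflect
  ; verts-apply     = ↭-trans (↭-reflexive (map-++ (reflect g) (map inj₁ elemsH) (map inj₂ elemsH)))
                        (↭-trans (++⁺ (map-intertwined-↭ (reflect g) inj₁ inj₂ (g -H_) (λ _ → refl) (map[g-x]↭elemsH g))
                                      (map-intertwined-↭ (reflect g) inj₂ inj₁ (g -H_) (λ _ → refl) (map[g-x]↭elemsH g)))
                                 (++-comm (map inj₂ elemsH) (map inj₁ elemsH)))
  }
  where
  injective : ∀ {x y} → reflect g x ≡ reflect g y → x ≡ y
  injective {inj₁ _} {inj₁ _} eq = cong inj₁ (-H-cancelˡ g (inj₂-injective eq))
  injective {inj₂ _} {inj₂ _} eq = cong inj₂ (-H-cancelˡ g (inj₁-injective eq))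
  adj-reflect : ∀ x y → adj (reflect g x) (reflect g y) ≡ adj x y
  adj-reflect (inj₁ p) (inj₁ q) = refl
  adj-reflect (inj₁ p) (inj₂ h) = cong Dset ([z-y]-[z-x]≡x-y p h g)
  adj-reflect (inj₂ h) (inj₁ p) = cong Dset ([z-y]-[z-x]≡x-y p h g)
  adj-reflect (inj₂ h) (inj₂ k) = refl

base : H ⊎ H
base = inj₁ 0H

toBase : H ⊎ H → Automorphism Dev
toBase (inj₁ q) = translation q
toBase (inj₂ q) = reflection q

moved : H ⊎ H → H ⊎ H → H ⊎ H
moved y = Automorphism.apply (toBase y)

moved-base : ∀ y → moved y y ≡ base
moved-base (inj₁ q) = cong inj₁ (x-x≡0 q)
moved-base (inj₂ q) = cong inj₁ (x-x≡0 q)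

reach-toBase : ∀ k x y → reach Dev k x y ≡ reach Dev k (moved y x) base
reach-toBase k x y = trans (sym (reach-apply Dev (toBase y) k x y)) (cong (reach Dev k (moved y x)) (moved-base y))

atDist-toBase : ∀ x y i → atDist Dev x y i ≡ atDist Dev (moved y x) base i
atDist-toBase x y i =
  trans (sym (atDist-apply Dev (toBase y) x y i)) (cong (λ w → atDist Dev (moved y x) w i) (moved-base y))

neighboursAt-toBase : ∀ x y i → neighboursAt Dev x y i ≡ neighboursAt Dev (moved y x) base i
neighboursAt-toBase x y i =
  trans (sym (neighboursAt-apply Dev (toBase y) x y i)) (cong (λ w → neighboursAt Dev (moved y x) w i) (moved-base y))

-- The blocks through 0 (those D + h with -h ∈ D) are at distance 1; every point outside N
-- shares μ = 4 > 0 blocks with 0, hence is at distance 2; the remaining blocks are at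
-- distance 3 and N ∖ {0} at distance 4.
distanceFromBase : H ⊎ H → ℕ
distanceFromBase (inj₁ p) = if p ==H 0H then 0 else if Nset p then 4 else 2
distanceFromBase (inj₂ h) = if Dset (0H -H h) then 1 else 3

ball : ℕ → H ⊎ H → Bool
ball k z = distanceFromBase z ≤ᵇ k

ball-saturated : ∀ k z → ball (4 + k) z ≡ true
ball-saturated k z = Equivalence.to T-≡ (≤⇒≤ᵇ (≤-trans distance≤4 (m≤m+n 4 k)))
  where
  distance≤4 : distanceFromBase z ≤ 4
  distance≤4 = ≤ᵇ⇒≤ (distanceFromBase z) 4 (allV-sound (ball 4) _ z)

expand-ball : ∀ k → expand Dev (ball k) ≗ ball (suc k)
expand-ball 0 = ≗-by-computation _
expand-ball 1 = ≗-by-computation _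
expand-ball 2 = ≗-by-computation _
expand-ball 3 = ≗-by-computation _
expand-ball (suc (suc (suc (suc k)))) z =
  trans (expand-inflationary Dev {ball (4 + k)} z (ball-saturated k z)) (sym (ball-saturated (suc k) z))

reach-ball : ∀ k → (λ z → reach Dev k z base) ≗ ball k
reach-ball zero    = ≗-by-computation _
reach-ball (suc k) z = trans (reach-suc Dev {k} {base} (reach-ball k) z) (expand-ball k z)

atDist-base : ∀ i z → atDist Dev z base i ≡ (distanceFromBase z ≡ᵇ i)
atDist-base zero    z = trans (reach-ball 0 z) (m≤ᵇ0≡m≡ᵇ0 (distanceFromBase z))
atDist-base (suc i) z = trans (cong₂ (λ a b → a ∧ not b) (reach-ball (suc i) z) (reach-ball i z))
                              ([m≤ᵇ1+n]∧¬[m≤ᵇn]≡[m≡ᵇ1+n] (distanceFromBase z) i)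

-- Distance-regularity

intersectionPredicate : ℕ → ℕ → ℕ → H ⊎ H → Bool
intersectionPredicate i j n x =
  not (distanceFromBase x ≡ᵇ i) ∨ (count (λ z → adj x z ∧ (distanceFromBase z ≡ᵇ j)) verts ≡ᵇ n)

intersectionCheck : ℕ → ℕ → ℕ → Bool
intersectionCheck i j n = allV (intersectionPredicate i j n)

neighboursAt-by-check : ∀ i j n → T (intersectionCheck i j n) →
                        ∀ x y → atDist Dev x y i ≡ true → neighboursAt Dev x y j ≡ n
neighboursAt-by-check i j n t x y x∈Γᵢ[y] = begin
  neighboursAt Dev x y j                                             ≡⟨ neighboursAt-toBase x y j ⟩
  neighboursAt Dev x′ base j                                         ≡⟨ count-cong (λ z → cong (adj x′ z ∧_) (atDist-base j z)) verts ⟩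
  count (λ z → adj x′ z ∧ (distanceFromBase z ≡ᵇ j)) verts           ≡⟨ ≡ᵇ⇒≡ _ n (T-∨-resolve (allV-sound (intersectionPredicate i j n) t x′) (cong not x′∈Γᵢ[base])) ⟩
  n                                                                  ∎
  where
  open ≡-Reasoning
  x′ = moved y x
  x′∈Γᵢ[base] : (distanceFromBase x′ ≡ᵇ i) ≡ true
  x′∈Γᵢ[base] = trans (sym (atDist-base i x′)) (trans (sym (atDist-toBase x y i)) x∈Γᵢ[y])

bs cs : Vec ℕ 4
bs = 12 ∷ 11 ∷ 8 ∷ 1 ∷ []
cs = 1 ∷ 4 ∷ 11 ∷ 12 ∷ []

Dev-isDistanceRegular : IsDistanceRegular Dev 4 bs cs
Dev-isDistanceRegular = adj-sym , adj-irrefl , connected , diameter-4 , b-numbers , c-numbers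
  where
  adj-sym : ∀ x y → adj x y ≡ adj y x
  adj-sym (inj₁ p) (inj₁ q) = refl
  adj-sym (inj₁ p) (inj₂ h) = refl
  adj-sym (inj₂ h) (inj₁ p) = refl
  adj-sym (inj₂ h) (inj₂ k) = refl
  adj-irrefl : ∀ x → adj x x ≡ false
  adj-irrefl (inj₁ p) = refl
  adj-irrefl (inj₂ h) = refl
  connected : ∀ x y → reach Dev 4 x y ≡ true
  connected x y = trans (reach-toBase 4 x y) (trans (reach-ball 4 (moved y x)) (ball-saturated 0 (moved y x)))
  diameter-4 : ∃[ x ] ∃[ y ] atDist Dev x y 4 ≡ true
  diameter-4 = inj₁ (# 0 , # 1 , # 0) , base , atDist-base 4 (inj₁ (# 0 , # 1 , # 0))
  b-numbers : ∀ x y (i : Fin 4) → atDist Dev x y (toℕ i) ≡ true → neighboursAt Dev x y (suc (toℕ i)) ≡ lookup bs i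
  b-numbers x y i = neighboursAt-by-check (toℕ i) (suc (toℕ i)) (lookup bs i)
    (allFin-sound (λ i → intersectionCheck (toℕ i) (suc (toℕ i)) (lookup bs i)) _ i) x y
  c-numbers : ∀ x y (i : Fin 4) → atDist Dev x y (suc (toℕ i)) ≡ true → neighboursAt Dev x y (toℕ i) ≡ lookup cs i
  c-numbers x y i = neighboursAt-by-check (suc (toℕ i)) (toℕ i) (lookup cs i)
    (allFin-sound (λ i → intersectionCheck (suc (toℕ i)) (toℕ i) (lookup cs i)) _ i) x y

-- The Cayley graph structure

open GeneralizedDihedral H-abelianGroup using (Dih; _≈ᴰ_; _·_; inv; dihedralGroup)

-- Points p ↦ (p , false) and blocks D + h ↦ the reflection (-h , true), so that x ~ y iff x y⁻¹
-- is a reflection (d , true) with d ∈ D.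
embed : H ⊎ H → Dih
embed (inj₁ p) = (p , false)
embed (inj₂ h) = (0H -H h , true)

connectionSet : Dih → Set
connectionSet (a , s) = s ≡ true × Dset a ≡ true

in-connectionSet⇔ : ∀ {a b} → a ≡ b → (Dset a ≡ true) ⇔ connectionSet (b , true)
in-connectionSet⇔ a≡b = mk⇔ (λ d → refl , trans (cong Dset (sym a≡b)) d) (λ (_ , d) → trans (cong Dset a≡b) d)

adj⇔connectionSet : ∀ x y → (adj x y ≡ true) ⇔ connectionSet (embed x · inv (embed y))
adj⇔connectionSet (inj₁ p) (inj₁ q) = mk⇔ (λ ()) (λ ())
adj⇔connectionSet (inj₁ p) (inj₂ h) = in-connectionSet⇔ (-H-as-+H p h)
adj⇔connectionSet (inj₂ h) (inj₁ p) = in-connectionSet⇔ (trans (-H-as-+H p h) (sym (y⁻¹∙x⁻¹⁻¹≈x-y p h)))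
adj⇔connectionSet (inj₂ h) (inj₂ k) = mk⇔ (λ ()) (λ ())

embed-injective : ∀ x y → embed x ≈ᴰ embed y → x ≡ y
embed-injective (inj₁ p) (inj₁ q) (p≡q , _) = cong inj₁ p≡q
embed-injective (inj₂ h) (inj₂ k) (e , _)   = cong inj₂ (⁻¹-injective e)

embed-surjective : ∀ g → ∃[ x ] embed x ≈ᴰ g
embed-surjective (a , false) = inj₁ a , refl , refl
embed-surjective (a , true)  = inj₂ (0H -H a) , ⁻¹-involutive a , refl

Dev-isCayleyGraph : IsCayleyGraph Dev
Dev-isCayleyGraph = dihedralGroup , connectionSet , embed , respects , inv-closed , (λ ()) ,
                    embed-injective , embed-surjective , adj⇔connectionSet
  where
  respects : ∀ {g h} → g ≈ᴰ h → connectionSet g → connectionSet h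
  respects (refl , refl) s = s
  inv-closed : ∀ g → connectionSet g → connectionSet (inv g)
  inv-closed (a , true) s = s

proposition4p3 : IsRDS 12 3 12 4 Nset Dset
                 × IsDistanceRegular (incidenceGraph Dset) 4 (12 ∷ 11 ∷ 8 ∷ 1 ∷ []) (1 ∷ 4 ∷ 11 ∷ 12 ∷ [])
                 × IsCayleyGraph (incidenceGraph Dset)
proposition4p3 = D-isRDS , Dev-isDistanceRegular , Dev-isCayleyGraph
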